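{- Let $H = (V, E)$ be a hypergraph of arity $d$ with $N$ vertices and $M$ hyperedges, let $\beta \in [0,1]$, and let $t$ and $q$ be positive integers. Suppose that $t$ divides $M$ and $1/t > \beta$. Let $\mathbf{P} \in \{0,1\}^{M \times N}$ be the indicator matrix of $H$, and let $\mathbf{T} = [\mathbf{A} \,\|\, \mathbf{Q}]$ be the $(t, q)$-VF tensor product of $\mathbf{P}$. Then for every vector $\mathbf{x} \in \mathbb{Z}^{M^q}$ with $\mathbf{x} \mathbf{A} = \mathbf{0}$, the set $E' \subseteq [M]^q$ of indices of the nonzero entries of $\mathbf{x}$ is $(t,q)$-legal.
   Context: Vectors are row vectors. The indicator matrix of a hypergraph of arity $d$ with $N$ vertices and $M$ hyperedges is $\mathbf{P}\in\{0,1\}^{M\times N}$ with one column per vertex and one row per hyperedge, each row having $1$s exactly at the $d$ vertices of that hyperedge. For positive integers $a>b$ with $a$ prime, an $(a,b)$ reduced Vandermonde matrix is $\mathbf{V}\in\mathbb{Z}^{(a-1)\times b}$ with $\mathbf{V}_{i,j}=i^{j-1}\bmod a$. The $(t,q)$-VF tensor product of $\mathbf{P}$ (with $t\mid M$) is: $\mathbf{Q}=\mathbf{P}^{\otimes q}$ (rows indexed by $[M]^q$, columns by $[N]^q$); $\mathcal{S}$ is the collection of all sets $\{(e_1,\dots,e_{\ell-1},e'_\ell,e_{\ell+1},\dots,e_q): e'_\ell\in[M]\}$ over $\ell\in[q]$ and fixed $e_1,\dots,e_{\ell-1},e_{\ell+1},\dots,e_q\in[M]$; with $a$ a prime in $(M^q,3M^q)$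 and $\mathbf{V}$ an $(a,M/t)$ reduced Vandermonde matrix whose first $M^q$ rows are indexed by distinct elements of $[M]^q$, for each $S\in\mathcal{S}$ the matrix $\mathbf{A}^{(S)}\in\mathbb{Z}^{M^q\times M/t}$ has row $\mathbf{e}$ equal to $\mathbf{V}_{\mathbf{e}}$ if $\mathbf{e}\in S$ and $\mathbf{0}$ otherwise; $\mathbf{A}$ is the horizontal concatenation of all $\mathbf{A}^{(S)}$, and $\mathbf{T}=[\mathbf{A}\,\|\,\mathbf{Q}]$. A subset $E'\subseteq[M]^q$ is $(t,q)$-legal if for all $\ell\in[q]$ and all $e_1,\dots,e_{\ell-1},e_{\ell+1},\dots,e_q\in[M]$, the intersection $E'\cap\{(e_1,\dots,e_{\ell-1},e'_\ell,e_{\ell+1},\dots,e_q):e'_\ell\in[M]\}$ has cardinality either $0$ or at least $M/t$.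
   Formalization: The parameter β is taken to be a rational number in $[0,1]$. -}

module Defs where

open import Data.Nat using (ℕ; zero; suc; _^_; _%_; _<_; _≤_; _*_; NonZero)
open import Data.Nat.Primality using (Prime)
open import Data.Fin using (Fin; toℕ)
import Data.Fin.Properties as FinP
open import Data.Fin.Subset using (Subset; _∈_; ∣_∣)
open import Data.Fin.Subset.Properties using (_∈?_)
open import Data.Integer using (ℤ; +_)
import Data.Integer as ℤ
open import Data.Vec using (Vec; []; _∷_; insertAt; removeAt; lookup)
open import Data.Vec.Properties using (≡-dec)
open import Data.List using (List; [_]; concatMap; map; foldr; allFin; filter; length)
open import Data.Product using (Σ; _×_)
open import Data.Sum using (_⊎_)
open import Data.Nat using (_/_)
open import Data.Bool using (if_then_else_)
open import Relation.Nullary using (does; ¬?)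
open import Relation.Unary using (Pred; Decidable)
open import Relation.Binary.PropositionalEquality using (_≡_)
open import Function.Definitions using (Injective)
import Level

record Hypergraph (d N M : ℕ) : Set where
  field
    edge  : Fin M → Subset N
    arity : ∀ (e : Fin M) → ∣ edge e ∣ ≡ d

indicator : ∀ {d N M} → Hypergraph d N M → Fin M → Fin N → ℤ
indicator H e v = if does (v ∈? Hypergraph.edge H e) then + 1 else + 0

tensorPow : ∀ {M N} (q : ℕ) → (Fin M → Fin N → ℤ) → Vec (Fin M) q → Vec (Fin N) q → ℤ
tensorPow zero    P []       []       = + 1
tensorPow (suc q) P (e ∷ es) (v ∷ vs) = P e v ℤ.* tensorPow q P es vs

allVecs : (M q : ℕ) → List (Vec (Fin M) q)
allVecs M zero    = [ [] ]
allVecs M (suc q) = concatMap (λ i → map (i ∷_) (allVecs M q)) (allFin M)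

sumℤ : List ℤ → ℤ
sumℤ = foldr ℤ._+_ (+ 0)

-- (a,b) reduced Vandermonde matrix entry: row i ∈ {1,…,a-1}, column j ∈ {1,…,b}
-- (j represented by j' = j-1 ∈ Fin b): V_{i,j} = i^{j-1} mod a.
vandermonde : (a : ℕ) .{{_ : NonZero a}} → ℕ → ℕ → ℤ
vandermonde a i j' = + ((i ^ j') % a)

-- The matrix A of the (t,q)-VF tensor product, with q = suc k.
-- ι assigns to each e ∈ [M]^q its row of V: row number suc (toℕ (ι e)), i.e. the
-- first M^q rows of V are indexed by the distinct elements of [M]^q.
-- Columns of A are indexed by (S, j) where S ∈ 𝒮 is given by ℓ ∈ [q] and the fixed
-- other coordinates r ∈ [M]^{q-1}: S = { insertAt r ℓ m : m ∈ [M] }, and j ∈ [M/t].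
VF-A : ∀ {M k b} (a : ℕ) .{{_ : NonZero a}} (ι : Vec (Fin M) (suc k) → Fin (M ^ suc k)) →
       (ℓ : Fin (suc k)) (r : Vec (Fin M) k) (j : Fin b) → Vec (Fin M) (suc k) → ℤ
VF-A a ι ℓ r j e =
  if does (≡-dec FinP._≟_ (removeAt e ℓ) r)
  then vandermonde a (suc (toℕ (ι e))) (toℕ j)
  else + 0

xA : ∀ {M k b} (a : ℕ) .{{_ : NonZero a}} (ι : Vec (Fin M) (suc k) → Fin (M ^ suc k)) →
     (Vec (Fin M) (suc k) → ℤ) → Fin (suc k) → Vec (Fin M) k → Fin b → ℤ
xA {M} {k} {b} a ι x ℓ r j =
  sumℤ (map (λ e → x e ℤ.* VF-A {b = b} a ι ℓ r j e) (allVecs M (suc k)))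

-- (t,q)-legal subsets E' ⊆ [M]^q (q = suc k), given as decidable predicates.
-- The line {(e_1,…,e'_ℓ,…,e_q) : e'_ℓ ∈ [M]} is { insertAt r ℓ m : m ∈ Fin M }.
Legal : ∀ {M k} (t : ℕ) .{{_ : NonZero t}} (E' : Pred (Vec (Fin M) (suc k)) Level.zero) →
        Decidable E' → Set
Legal {M} {k} t E' E'? =
  ∀ (ℓ : Fin (suc k)) (r : Vec (Fin M) k) →
    let c = length (filter (λ m → E'? (insertAt r ℓ m)) (allFin M))
    in (c ≡ 0) ⊎ (M / t ≤ c)

module Submission where

-- Fix a line {insertAt r ℓ m : m ∈ [M]} and put y_m = x (insertAt r ℓ m) and
-- n_m = 1 + ι (insertAt r ℓ m); the nodes n_m are distinct and lie in [1, a).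
-- The columns of A belonging to the line say that the reduced moments
-- Σ_m y_m (n_m^j mod a) vanish for j < M/t. Suppose that only c ≤ M/t of the y_m
-- are nonzero. Since a is prime, the c × c Vandermonde matrix at their nodes is
-- invertible modulo every power of a. If a^K divides every y_m, then reduced and
-- true moments agree modulo a^(K+1), so a^(K+1) divides every y_m as well. Hence
-- all y_m are divisible by arbitrarily large powers of a, so they vanish and c = 0.

open import Defs

module SumℤProperties where

  open import Data.Nat using (ℕ; suc)
  open import Data.Fin using (Fin; zero; suc)
  import Data.Fin.Properties as FinP
  open import Data.Integer using (ℤ; 0ℤ; _+_; _-_)
  import Data.Integer.Properties as ℤP
  open import Data.Integer.Divisibility.Signed using (_∣_; divides; ∣m∣n⇒∣m+n)
  open import Data.Integer.Tactic.RingSolver using (solve-∀)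
  open import Data.List using (List; []; _∷_; _++_; map; concatMap; tabulate; allFin; filter)
  import Data.List.Properties as LP
  open import Data.List.Relation.Unary.All using (All; []; _∷_)
  open import Data.Vec using (Vec; []; _∷_; insertAt; removeAt)
  import Data.Vec.Properties as VP
  open import Function using (_∘_; id)
  open import Relation.Nullary using (¬_; yes; no)
  open import Relation.Unary using (Pred; Decidable)
  open import Relation.Binary.PropositionalEquality
  open ≡-Reasoning

  sumℤ-++ : ∀ (xs ys : List ℤ) → sumℤ (xs ++ ys) ≡ sumℤ xs + sumℤ ys
  sumℤ-++ []       ys = sym (ℤP.+-identityˡ _)
  sumℤ-++ (x ∷ xs) ys = trans (cong (_+_ x) (sumℤ-++ xs ys)) (sym (ℤP.+-assoc x _ _))

  module _ {A : Set} where

    sumℤ-map-zero : ∀ (f : A → ℤ) → (∀ x → f x ≡ 0ℤ) → ∀ xs → sumℤ (map f xs) ≡ 0ℤ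
    sumℤ-map-zero f f≡0 []       = refl
    sumℤ-map-zero f f≡0 (x ∷ xs) = cong₂ _+_ (f≡0 x) (sumℤ-map-zero f f≡0 xs)

    sumℤ-map-filter : ∀ {p} {P : Pred A p} (P? : Decidable P) (f : A → ℤ) → (∀ x → ¬ P x → f x ≡ 0ℤ) →
                      ∀ xs → sumℤ (map f (filter P? xs)) ≡ sumℤ (map f xs)
    sumℤ-map-filter P? f f≡0 [] = refl
    sumℤ-map-filter P? f f≡0 (x ∷ xs) with P? x
    ... | yes _  = cong (_+_ (f x)) (sumℤ-map-filter P? f f≡0 xs)
    ... | no ¬Px = begin
      sumℤ (map f (filter P? xs))  ≡⟨ sumℤ-map-filter P? f f≡0 xs ⟩
      sumℤ (map f xs)              ≡⟨ ℤP.+-identityˡ _ ⟨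
      0ℤ + sumℤ (map f xs)         ≡⟨ cong (_+ sumℤ (map f xs)) (f≡0 x ¬Px) ⟨
      f x + sumℤ (map f xs)        ∎

    ∣-sumℤ-map : ∀ {d} (f : A → ℤ) {xs} → All (λ x → d ∣ f x) xs → d ∣ sumℤ (map f xs)
    ∣-sumℤ-map f []           = divides 0ℤ refl
    ∣-sumℤ-map f (d∣fx ∷ d∣f) = ∣m∣n⇒∣m+n d∣fx (∣-sumℤ-map f d∣f)

    ∣-sumℤ-map-difference : ∀ {d} (f g : A → ℤ) {xs} → All (λ x → d ∣ f x - g x) xs →
                            d ∣ sumℤ (map f xs) - sumℤ (map g xs)
    ∣-sumℤ-map-difference f g []                     = divides 0ℤ refl
    ∣-sumℤ-map-difference f g {x ∷ xs} (d∣fx-gx ∷ d∣f-g) =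
      subst (_ ∣_) (interchange (f x) (g x) (sumℤ (map f xs)) (sumℤ (map g xs)))
            (∣m∣n⇒∣m+n d∣fx-gx (∣-sumℤ-map-difference f g d∣f-g))
      where
      interchange : ∀ a b s t → (a - b) + (s - t) ≡ (a + s) - (b + t)
      interchange = solve-∀

    sumℤ-map-concatMap : ∀ {B : Set} (F : B → ℤ) (f : A → List B) xs →
                         sumℤ (map F (concatMap f xs)) ≡ sumℤ (map (λ x → sumℤ (map F (f x))) xs)
    sumℤ-map-concatMap F f []       = refl
    sumℤ-map-concatMap F f (x ∷ xs) = begin
      sumℤ (map F (f x ++ concatMap f xs))
        ≡⟨ cong sumℤ (LP.map-++ F (f x) _) ⟩
      sumℤ (map F (f x) ++ map F (concatMap f xs))
        ≡⟨ sumℤ-++ (map F (f x)) _ ⟩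
      sumℤ (map F (f x)) + sumℤ (map F (concatMap f xs))
        ≡⟨ cong (_+_ (sumℤ (map F (f x)))) (sumℤ-map-concatMap F f xs) ⟩
      sumℤ (map F (f x)) + sumℤ (map (λ x → sumℤ (map F (f x))) xs)
        ∎

  sumℤ-tabulate-delta : ∀ {n} (i₀ : Fin n) (h : Fin n → ℤ) → (∀ i → i ≢ i₀ → h i ≡ 0ℤ) →
                        sumℤ (tabulate h) ≡ h i₀
  sumℤ-tabulate-delta zero h h≡0 = begin
    h zero + sumℤ (tabulate (h ∘ suc))  ≡⟨ cong (_+_ (h zero)) rest≡0 ⟩
    h zero + 0ℤ                         ≡⟨ ℤP.+-identityʳ _ ⟩
    h zero                              ∎
    where
    rest≡0 : sumℤ (tabulate (h ∘ suc)) ≡ 0ℤ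
    rest≡0 = trans (cong sumℤ (sym (LP.map-tabulate id (h ∘ suc))))
                   (sumℤ-map-zero (h ∘ suc) (λ i → h≡0 (suc i) λ ()) (allFin _))
  sumℤ-tabulate-delta (suc i₀) h h≡0 = begin
    h zero + sumℤ (tabulate (h ∘ suc))
      ≡⟨ cong₂ _+_ (h≡0 zero λ ()) (sumℤ-tabulate-delta i₀ (h ∘ suc) rest≡0) ⟩
    0ℤ + h (suc i₀)                     ≡⟨ ℤP.+-identityˡ _ ⟩
    h (suc i₀)                          ∎
    where
    rest≡0 : ∀ i → i ≢ i₀ → h (suc i) ≡ 0ℤ
    rest≡0 i i≢i₀ = h≡0 (suc i) (i≢i₀ ∘ FinP.suc-injective)

  sumℤ-allFin-delta : ∀ {n} (i₀ : Fin n) (h : Fin n → ℤ) → (∀ i → i ≢ i₀ → h i ≡ 0ℤ) →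
                      sumℤ (map h (allFin n)) ≡ h i₀
  sumℤ-allFin-delta i₀ h h≡0 = trans (cong sumℤ (LP.map-tabulate id h)) (sumℤ-tabulate-delta i₀ h h≡0)

  module _ {M : ℕ} where

    sumℤ-allVecs-suc : ∀ k (F : Vec (Fin M) (suc k) → ℤ) →
      sumℤ (map F (allVecs M (suc k))) ≡ sumℤ (map (λ i → sumℤ (map (F ∘ (i ∷_)) (allVecs M k))) (allFin M))
    sumℤ-allVecs-suc k F =
      trans (sumℤ-map-concatMap F (λ i → map (i ∷_) (allVecs M k)) (allFin M))
            (cong sumℤ (LP.map-cong (λ i → cong sumℤ (sym (LP.map-∘ (allVecs M k)))) (allFin M)))

    sumℤ-allVecs-delta : ∀ {k} (v₀ : Vec (Fin M) k) (G : Vec (Fin M) k → ℤ) →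
                         (∀ v → v ≢ v₀ → G v ≡ 0ℤ) → sumℤ (map G (allVecs M k)) ≡ G v₀
    sumℤ-allVecs-delta []        G G≡0 = ℤP.+-identityʳ (G [])
    sumℤ-allVecs-delta (i₀ ∷ v₀) G G≡0 = begin
      sumℤ (map G (allVecs M _))
        ≡⟨ sumℤ-allVecs-suc _ G ⟩
      sumℤ (map (λ i → sumℤ (map (G ∘ (i ∷_)) (allVecs M _))) (allFin M))
        ≡⟨ cong sumℤ (LP.map-cong inner (allFin M)) ⟩
      sumℤ (map (λ i → G (i ∷ v₀)) (allFin M))
        ≡⟨ sumℤ-allFin-delta i₀ _ outer ⟩
      G (i₀ ∷ v₀)
        ∎
      where
      inner : ∀ i → sumℤ (map (G ∘ (i ∷_)) (allVecs M _)) ≡ G (i ∷ v₀)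
      inner i = sumℤ-allVecs-delta v₀ (G ∘ (i ∷_)) (λ v v≢v₀ → G≡0 _ (v≢v₀ ∘ VP.∷-injectiveʳ))
      outer : ∀ i → i ≢ i₀ → G (i ∷ v₀) ≡ 0ℤ
      outer i i≢i₀ = G≡0 _ (i≢i₀ ∘ VP.∷-injectiveˡ)

    removeAt-∷-suc : ∀ {k} (i : Fin M) (w : Vec (Fin M) (suc k)) ℓ → removeAt (i ∷ w) (suc ℓ) ≡ i ∷ removeAt w ℓ
    removeAt-∷-suc i (_ ∷ _) ℓ = refl

    sumℤ-allVecs-line : ∀ {k} (ℓ : Fin (suc k)) (r : Vec (Fin M) k) (F : Vec (Fin M) (suc k) → ℤ) →
                        (∀ e → removeAt e ℓ ≢ r → F e ≡ 0ℤ) →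
                        sumℤ (map F (allVecs M (suc k))) ≡ sumℤ (map (λ m → F (insertAt r ℓ m)) (allFin M))
    sumℤ-allVecs-line zero r F F≡0 =
      trans (sumℤ-allVecs-suc _ F)
            (cong sumℤ (LP.map-cong (λ i → sumℤ-allVecs-delta r (F ∘ (i ∷_)) (F≡0 ∘ (i ∷_))) (allFin M)))
    sumℤ-allVecs-line (suc ℓ) (r₀ ∷ r) F F≡0 = begin
      sumℤ (map F (allVecs M _))
        ≡⟨ sumℤ-allVecs-suc _ F ⟩
      sumℤ (map (λ i → sumℤ (map (F ∘ (i ∷_)) (allVecs M _))) (allFin M))
        ≡⟨ sumℤ-allFin-delta r₀ _ off-r₀ ⟩
      sumℤ (map (F ∘ (r₀ ∷_)) (allVecs M _))
        ≡⟨ sumℤ-allVecs-line ℓ r (F ∘ (r₀ ∷_)) on-r₀ ⟩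
      sumℤ (map (λ m → F (r₀ ∷ insertAt r ℓ m)) (allFin M))
        ∎
      where
      off-r₀ : ∀ i → i ≢ r₀ → sumℤ (map (F ∘ (i ∷_)) (allVecs M _)) ≡ 0ℤ
      off-r₀ i i≢r₀ = sumℤ-map-zero (F ∘ (i ∷_))
        (λ w → F≡0 (i ∷ w) (i≢r₀ ∘ VP.∷-injectiveˡ ∘ trans (sym (removeAt-∷-suc i w ℓ)))) (allVecs M _)
      on-r₀ : ∀ w → removeAt w ℓ ≢ r → F (r₀ ∷ w) ≡ 0ℤ
      on-r₀ w w≢r = F≡0 (r₀ ∷ w) (w≢r ∘ VP.∷-injectiveʳ ∘ trans (sym (removeAt-∷-suc r₀ w ℓ)))

module Moments where

  open SumℤProperties using (∣-sumℤ-map; ∣-sumℤ-map-difference)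
  open import Data.Nat as ℕ using (ℕ; zero; suc; _^_; _<_; z<s; s≤s; z≤n; NonZero)
  import Data.Nat.Properties as ℕP
  import Data.Nat.Divisibility as ℕD
  import Data.Nat.Coprimality as ℕC
  open import Data.Nat.Primality using (Prime)
  open import Data.Integer using (ℤ; +_; 0ℤ; _+_; _-_; _*_; ∣_∣; _/ℕ_)
  import Data.Integer.Properties as ℤP
  open import Data.Integer.Coprimality using (Coprime; coprime-divisor)
  open import Data.Integer.DivMod using (a≡a%ℕn+[a/ℕn]*n)
  open import Data.Integer.Divisibility.Signed
    using ( _∣_; divides; ∣-trans; ∣ᵤ⇒∣; ∣⇒∣ᵤ; ∣m∣n⇒∣m-n; ∣n⇒∣m*n; ∣m⇒∣m*n; ∣m+n∣n⇒∣m
          ; *-monoʳ-∣; *-monoˡ-∣)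
  open import Data.Integer.Tactic.RingSolver using (solve-∀)
  open import Data.List using (List; []; _∷_; map; length)
  open import Data.List.Relation.Unary.All as All using (All; []; _∷_)
  open import Data.List.Relation.Unary.AllPairs as AllPairs using (AllPairs; _∷_)
  open import Data.Product using (_,_; _×_)
  open import Function using (_∘_)
  open import Relation.Nullary using (yes; no; contradiction)
  open import Relation.Binary.PropositionalEquality
  open ≡-Reasoning

  n<m^n : ∀ {m} → 1 < m → ∀ n → n < m ^ n
  n<m^n     1<m zero    = s≤s z≤n
  n<m^n {m} 1<m (suc n) = ℕP.≤-trans
    (ℕP.+-mono-≤ (ℕP.≤-trans (s≤s z≤n) (n<m^n 1<m n)) (ℕP.≤-trans (n<m^n 1<m n) (ℕP.m≤m+n (m ^ n) 0)))
    (ℕP.*-monoˡ-≤ (m ^ n) 1<m)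

  ∣-all-powers⇒≡0 : ∀ {p} → 1 < p → ∀ y → (∀ K → + (p ^ K) ∣ y) → y ≡ 0ℤ
  ∣-all-powers⇒≡0 1<p y p^K∣y with ∣ y ∣ ℕ.≟ 0
  ... | yes ∣y∣≡0 = ℤP.∣i∣≡0⇒i≡0 ∣y∣≡0
  ... | no  ∣y∣≢0 = contradiction (ℕD.∣⇒≤ {{ℕ.≢-nonZero ∣y∣≢0}} (∣⇒∣ᵤ (p^K∣y ∣ y ∣)))
                                  (ℕP.<⇒≱ (n<m^n 1<p ∣ y ∣))

  coprime-* : ∀ {m n o} → ℕC.Coprime m o → ℕC.Coprime n o → ℕC.Coprime (m ℕ.* n) o
  coprime-* m⊥o n⊥o (d∣mn , d∣o) =
    n⊥o (ℕC.coprime-divisor (λ (e∣d , e∣m) → m⊥o (e∣m , ℕD.∣-trans e∣d d∣o)) d∣mn , d∣o)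

  coprime-^ : ∀ {m n} → ℕC.Coprime m n → ∀ K → ℕC.Coprime (m ^ K) n
  coprime-^ {n = n} m⊥n zero    = ℕC.1-coprimeTo n
  coprime-^         m⊥n (suc K) = coprime-* m⊥n (coprime-^ m⊥n K)

  coprime-cancelʳ : ∀ {d u} y → Coprime d u → d ∣ y * u → d ∣ y
  coprime-cancelʳ {d} {u} y d⊥u d∣yu =
    ∣ᵤ⇒∣ (coprime-divisor d u y d⊥u (∣⇒∣ᵤ (subst (d ∣_) (ℤP.*-comm y u) d∣yu)))

  *-pres-∣ : ∀ {i j m n} → i ∣ m → j ∣ n → i * j ∣ m * n
  *-pres-∣ {i} {j} {m} {n} i∣m j∣n = ∣-trans (*-monoˡ-∣ j i∣m) (*-monoʳ-∣ m j∣n)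

  distinct-below⇒coprime-difference : ∀ {p m n} → Prime p → m < p → n < p → m ≢ n → Coprime (+ p) (+ m - + n)
  distinct-below⇒coprime-difference {p} {m} {n} p-prime m<p n<p m≢n =
    ℕC.prime⇒coprime p-prime {{ℕ.≢-nonZero ∣m-n∣≢0}} ∣m-n∣<p
    where
    ∣m-n∣<p : ∣ + m - + n ∣ < p
    ∣m-n∣<p = ℕP.≤-<-trans (ℕP.≤-reflexive (cong ∣_∣ (ℤP.m-n≡m⊖n m n)))
                           (ℕP.≤-<-trans (ℤP.∣m⊝n∣≤m⊔n m n) (ℕP.⊔-lub m<p n<p))
    ∣m-n∣≢0 : ∣ + m - + n ∣ ≢ 0
    ∣m-n∣≢0 = m≢n ∘ ℤP.+-injective ∘ ℤP.i-j≡0⇒i≡j (+ m) (+ n) ∘ ℤP.∣i∣≡0⇒i≡0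

  module _ {B : Set} (node : B → ℕ) where

    moment : (B → ℤ) → List B → ℕ → ℤ
    moment y bs j = sumℤ (map (λ b → y b * + (node b ^ j)) bs)

    moment-shift : ∀ c y bs j →
      moment (λ b → y b * (+ node b - + c)) bs j ≡ moment y bs (suc j) - + c * moment y bs j
    moment-shift c y []       j = sym (cong (_-_ 0ℤ) (ℤP.*-zeroʳ (+ c)))
    moment-shift c y (b ∷ bs) j = begin
      y b * (+ n - + c) * + (n ^ j) + moment y′ bs j
        ≡⟨ cong (_+_ (y b * (+ n - + c) * + (n ^ j))) (moment-shift c y bs j) ⟩
      y b * (+ n - + c) * + (n ^ j) + (moment y bs (suc j) - + c * moment y bs j)
        ≡⟨ regroup (y b) (+ n) (+ c) (+ (n ^ j)) _ _ ⟩
      y b * (+ n * + (n ^ j)) + moment y bs (suc j) - + c * (y b * + (n ^ j) + moment y bs j)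
        ≡⟨ cong (λ z → y b * z + moment y bs (suc j) - + c * (y b * + (n ^ j) + moment y bs j))
                (ℤP.pos-* n (n ^ j)) ⟨
      moment y (b ∷ bs) (suc j) - + c * moment y (b ∷ bs) j
        ∎
      where
      n  = node b
      y′ = λ b → y b * (+ node b - + c)
      regroup : ∀ y n c m s₁ s₀ → y * (n - c) * m + (s₁ - c * s₀) ≡ y * (n * m) + s₁ - c * (y * m + s₀)
      regroup = solve-∀

    -- Multiplying every coefficient by n_b − n_b₀ removes the node b₀ and turns the
    -- moments into the differences m_(j+1) − n_b₀ m_j (one elimination step on the
    -- Vandermonde matrix); coprimality then cancels the factors n_b − n_b₀ again.
    moments-∣⇒coefficients-∣ : ∀ d y bs → AllPairs (λ b b′ → Coprime d (+ node b′ - + node b)) bs →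
                               (∀ j → j < length bs → d ∣ moment y bs j) → All (λ b → d ∣ y b) bs
    moments-∣⇒coefficients-∣ d y []        _             _          = []
    moments-∣⇒coefficients-∣ d y (b₀ ∷ bs) (b₀⊥bs ∷ bs⊥) d∣moments = d∣y₀ ∷ d∣ys
      where
      y′ = λ b → y b * (+ node b - + node b₀)

      drop-b₀ : ∀ j → moment y′ (b₀ ∷ bs) j ≡ moment y′ bs j
      drop-b₀ j = vanishes (y b₀) (+ node b₀) (+ (node b₀ ^ j)) (moment y′ bs j)
        where
        vanishes : ∀ y n m s → y * (n - n) * m + s ≡ s
        vanishes = solve-∀

      d∣shifted : ∀ j → j < length bs → d ∣ moment y′ bs j
      d∣shifted j j<n = subst (d ∣_) (trans (sym (moment-shift (node b₀) y (b₀ ∷ bs) j)) (drop-b₀ j))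
        (∣m∣n⇒∣m-n (d∣moments (suc j) (s≤s j<n))
                   (∣n⇒∣m*n (+ node b₀) (d∣moments j (ℕP.m<n⇒m<1+n j<n))))

      d∣ys : All (λ b → d ∣ y b) bs
      d∣ys = All.zipWith cancel (b₀⊥bs , moments-∣⇒coefficients-∣ d y′ bs bs⊥ d∣shifted)
        where
        cancel : ∀ {b} → Coprime d (+ node b - + node b₀) × d ∣ y′ b → d ∣ y b
        cancel {b} (b₀⊥b , d∣y′b) = coprime-cancelʳ (y b) b₀⊥b d∣y′b

      d∣y₀ : d ∣ y b₀
      d∣y₀ = subst (d ∣_) (ℤP.*-identityʳ (y b₀))
        (∣m+n∣n⇒∣m (d∣moments 0 z<s) (∣-sumℤ-map _ (All.map (∣m⇒∣m*n (+ 1)) d∣ys)))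

  module _ (p : ℕ) .{{_ : NonZero p}} {B : Set} (node : B → ℕ) where

    reducedMoment : (B → ℤ) → List B → ℕ → ℤ
    reducedMoment y bs j = sumℤ (map (λ b → y b * vandermonde p (node b) j) bs)

    ∣m-m%p : ∀ m → + p ∣ + m - + (m ℕ.% p)
    ∣m-m%p m = divides (+ m /ℕ p) (begin
      + m - + r                     ≡⟨ cong (_- + r) (a≡a%ℕn+[a/ℕn]*n (+ m) p) ⟩
      + r + (+ m /ℕ p) * + p - + r  ≡⟨ cancel (+ r) _ ⟩
      (+ m /ℕ p) * + p              ∎)
      where
      r = m ℕ.% p
      cancel : ∀ r s → r + s - r ≡ s
      cancel = solve-∀

    moment-reducedMoment-∣ : ∀ d y bs j → All (λ b → d ∣ y b) bs →
                             d * + p ∣ moment node y bs j - reducedMoment y bs j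
    moment-reducedMoment-∣ d y bs j d∣ys = ∣-sumℤ-map-difference _ _ (All.map termwise d∣ys)
      where
      termwise : ∀ {b} → d ∣ y b → d * + p ∣ y b * + (node b ^ j) - y b * vandermonde p (node b) j
      termwise {b} d∣y = subst (d * + p ∣_) (distrib (y b) _ _) (*-pres-∣ d∣y (∣m-m%p (node b ^ j)))
        where
        distrib : ∀ y m r → y * (m - r) ≡ y * m - y * r
        distrib = solve-∀

    reducedMoments-vanish⇒^∣ : ∀ y bs → AllPairs (λ b b′ → Coprime (+ p) (+ node b′ - + node b)) bs →
                               (∀ j → j < length bs → reducedMoment y bs j ≡ 0ℤ) →
                               ∀ K → All (λ b → + (p ^ K) ∣ y b) bs
    reducedMoments-vanish⇒^∣ y bs bs⊥ vanish zero    = All.universal (λ b → ∣ᵤ⇒∣ (ℕD.1∣ ∣ y b ∣)) bs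
    reducedMoments-vanish⇒^∣ y bs bs⊥ vanish (suc K) =
      moments-∣⇒coefficients-∣ node (+ (p ^ suc K)) y bs bs⊥ᴷ
        (λ j j<n → subst₂ _∣_ p^K*p≡p^[1+K] (moment-eq j j<n)
          (moment-reducedMoment-∣ (+ (p ^ K)) y bs j (reducedMoments-vanish⇒^∣ y bs bs⊥ vanish K)))
      where
      bs⊥ᴷ : AllPairs (λ b b′ → Coprime (+ (p ^ suc K)) (+ node b′ - + node b)) bs
      bs⊥ᴷ = AllPairs.map raise bs⊥
        where
        raise : ∀ {b b′} → Coprime (+ p) (+ node b′ - + node b) → Coprime (+ (p ^ suc K)) (+ node b′ - + node b)
        raise b⊥b′ = coprime-^ b⊥b′ (suc K)
      p^K*p≡p^[1+K] : + (p ^ K) * + p ≡ + (p ^ suc K)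
      p^K*p≡p^[1+K] = trans (sym (ℤP.pos-* (p ^ K) p)) (cong +_ (ℕP.*-comm (p ^ K) p))
      moment-eq : ∀ j → j < length bs → moment node y bs j - reducedMoment y bs j ≡ moment node y bs j
      moment-eq j j<n = trans (cong (_-_ (moment node y bs j)) (vanish j j<n)) (ℤP.+-identityʳ _)

    reducedMoments-vanish⇒coefficients-vanish :
      1 < p → ∀ y bs → AllPairs (λ b b′ → Coprime (+ p) (+ node b′ - + node b)) bs →
      (∀ j → j < length bs → reducedMoment y bs j ≡ 0ℤ) → All (λ b → y b ≡ 0ℤ) bs
    reducedMoments-vanish⇒coefficients-vanish 1<p y bs bs⊥ vanish = All.tabulate λ b∈bs →
      ∣-all-powers⇒≡0 1<p _ (λ K → All.lookup (reducedMoments-vanish⇒^∣ y bs bs⊥ vanish K) b∈bs)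

module Lines where

  open SumℤProperties using (sumℤ-map-filter; sumℤ-allVecs-line)
  open Moments using (reducedMoment; reducedMoments-vanish⇒coefficients-vanish; distinct-below⇒coprime-difference)
  open import Data.Nat as ℕ using (ℕ; suc; _^_; _<_; _≤_; s≤s; NonZero)
  import Data.Nat.Properties as ℕP
  open import Data.Nat.Primality using (Prime; prime⇒nonTrivial)
  open import Data.Fin using (Fin; toℕ; fromℕ<)
  import Data.Fin.Properties as FinP
  open import Data.Integer using (ℤ; +_; 0ℤ; _*_; _-_; _≟_)
  import Data.Integer.Properties as ℤP
  open import Data.Integer.Coprimality using (Coprime)
  open import Data.Bool using (Bool; if_then_else_)
  open import Data.List using (List; []; _∷_; map; length; filter; allFin)
  import Data.List.Properties as LP
  open import Data.List.Relation.Unary.All using (All; []; _∷_)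
  import Data.List.Relation.Unary.All.Properties as AllP
  open import Data.List.Relation.Unary.AllPairs as AllPairs using (AllPairs)
  import Data.List.Relation.Unary.Unique.Propositional.Properties as UniqueP
  open import Data.Vec using (Vec; insertAt; removeAt; lookup)
  open import Data.Vec.Properties using (≡-dec; removeAt-insertAt; insertAt-lookup)
  open import Function using (_∘_)
  open import Function.Definitions using (Injective)
  open import Relation.Nullary using (¬_; ¬?; Dec; does; contradiction)
  open import Relation.Nullary.Decidable using (dec-true; dec-false; decidable-stable)
  open import Relation.Binary.PropositionalEquality
  open ≡-Reasoning

  module Line {M k : ℕ} (ι : Vec (Fin M) (suc k) → Fin (M ^ suc k)) (x : Vec (Fin M) (suc k) → ℤ)
              (ℓ : Fin (suc k)) (r : Vec (Fin M) k) where

    point : Fin M → Vec (Fin M) (suc k)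
    point = insertAt r ℓ

    node : Fin M → ℕ
    node m = suc (toℕ (ι (point m)))

    coeff : Fin M → ℤ
    coeff m = x (point m)

    support : List (Fin M)
    support = filter (λ m → ¬? (coeff m ≟ 0ℤ)) (allFin M)

    xA≡reducedMoment : ∀ a .{{_ : NonZero a}} {L} (j : Fin L) →
                       xA a ι x ℓ r j ≡ reducedMoment a node coeff support (toℕ j)
    xA≡reducedMoment a j = begin
      xA a ι x ℓ r j                                 ≡⟨ sumℤ-allVecs-line ℓ r F off-line ⟩
      sumℤ (map (F ∘ point) (allFin M))              ≡⟨ cong sumℤ (LP.map-cong on-line (allFin M)) ⟩
      reducedMoment a node coeff (allFin M) (toℕ j)  ≡⟨ sumℤ-map-filter _ _ zero-coeff (allFin M) ⟨
      reducedMoment a node coeff support (toℕ j)     ∎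
      where
      on? : ∀ e → Dec (removeAt e ℓ ≡ r)
      on? e = ≡-dec FinP._≟_ (removeAt e ℓ) r
      term : Vec (Fin M) (suc k) → Bool → ℤ
      term e b = x e * (if b then vandermonde a (suc (toℕ (ι e))) (toℕ j) else 0ℤ)
      F : Vec (Fin M) (suc k) → ℤ
      F e = term e (does (on? e))
      off-line : ∀ e → removeAt e ℓ ≢ r → F e ≡ 0ℤ
      off-line e e∉S = trans (cong (term e) (dec-false (on? e) e∉S)) (ℤP.*-zeroʳ (x e))
      on-line : ∀ m → F (point m) ≡ coeff m * vandermonde a (node m) (toℕ j)
      on-line m = cong (term (point m)) (dec-true (on? (point m)) (removeAt-insertAt r ℓ m))
      zero-coeff : ∀ m → ¬ ¬ coeff m ≡ 0ℤ → coeff m * vandermonde a (node m) (toℕ j) ≡ 0ℤ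
      zero-coeff m ¬¬y≡0 = trans (cong (_* column) (decidable-stable (coeff m ≟ 0ℤ) ¬¬y≡0)) (ℤP.*-zeroˡ column)
        where
        column = vandermonde a (node m) (toℕ j)

    node-injective : Injective _≡_ _≡_ ι → Injective _≡_ _≡_ node
    node-injective ι-injective {m} {m′} node≡ = begin
      m                    ≡⟨ insertAt-lookup r ℓ m ⟨
      lookup (point m) ℓ   ≡⟨ cong (λ v → lookup v ℓ) point≡ ⟩
      lookup (point m′) ℓ  ≡⟨ insertAt-lookup r ℓ m′ ⟩
      m′                   ∎
      where
      point≡ : point m ≡ point m′
      point≡ = ι-injective (FinP.toℕ-injective (ℕP.suc-injective node≡))

    support-coprime : ∀ {a} → Prime a → M ^ suc k < a → Injective _≡_ _≡_ ι →
                      AllPairs (λ m m′ → Coprime (+ a) (+ node m′ - + node m)) support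
    support-coprime {a} a-prime M^q<a ι-injective = AllPairs.map coprime (UniqueP.filter⁺ _ (UniqueP.allFin⁺ M))
      where
      node<a : ∀ m → node m < a
      node<a m = ℕP.<-≤-trans (s≤s (FinP.toℕ<n (ι (point m)))) M^q<a
      coprime : ∀ {m m′} → m ≢ m′ → Coprime (+ a) (+ node m′ - + node m)
      coprime m≢m′ = distinct-below⇒coprime-difference a-prime (node<a _) (node<a _)
                                                        (m≢m′ ∘ sym ∘ node-injective ι-injective)

    support-short⇒empty : ∀ {a L} .{{_ : NonZero a}} → Prime a → M ^ suc k < a → Injective _≡_ _≡_ ι →
                          (∀ (j : Fin L) → xA a ι x ℓ r j ≡ 0ℤ) → length support ≤ L → length support ≡ 0
    support-short⇒empty {a} a-prime M^q<a ι-injective xA≡0 c≤L =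
      empty (reducedMoments-vanish⇒coefficients-vanish a node 1<a coeff support
               (support-coprime a-prime M^q<a ι-injective) reducedMoments≡0)
            (AllP.all-filter _ (allFin M))
      where
      1<a : 1 < a
      1<a = ℕ.nonTrivial⇒n>1 a {{prime⇒nonTrivial a-prime}}
      reducedMoments≡0 : ∀ j → j < length support → reducedMoment a node coeff support j ≡ 0ℤ
      reducedMoments≡0 j j<c = subst (λ i → reducedMoment a node coeff support i ≡ 0ℤ) (FinP.toℕ-fromℕ< j<L)
        (trans (sym (xA≡reducedMoment a (fromℕ< j<L))) (xA≡0 (fromℕ< j<L)))
        where
        j<L = ℕP.<-≤-trans j<c c≤L
      empty : ∀ {ms} → All (λ m → coeff m ≡ 0ℤ) ms → All (λ m → coeff m ≢ 0ℤ) ms → length ms ≡ 0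
      empty []          []          = refl
      empty (y≡0 ∷ _)   (y≢0 ∷ _)   = contradiction y≡0 y≢0

open import Data.Nat using (ℕ; suc; _^_; _<_; _*_; _/_; NonZero)
open import Data.Nat.Divisibility using (_∣_)
open import Data.Nat.Primality using (Prime)
open import Data.Fin using (Fin)
open import Data.Vec using (Vec)
open import Data.Integer using (ℤ; +_; _≟_)
open import Data.Rational using (ℚ; 0ℚ; 1ℚ; _≤_) renaming (_<_ to _<ℚ_; _/_ to _/ℚ_)
open import Relation.Nullary using (¬_; ¬?)
open import Relation.Binary.PropositionalEquality using (_≡_)
open import Function.Definitions using (Injective)
import Data.Nat.Properties as ℕP
open import Data.List using (length)
open import Data.Sum using (inj₁; inj₂; [_,_]′)
open import Function using (_∘_)
open Lines using (module Line)

lemma4p7 : ∀ (d N M : ℕ) (H : Hypergraph d N M) (β : ℚ) → 0ℚ ≤ β → β ≤ 1ℚ →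
    ∀ (t : ℕ) .{{_ : NonZero t}} (k : ℕ) →
    t ∣ M → β <ℚ (+ 1 /ℚ t) →
    ∀ (a : ℕ) .{{_ : NonZero a}} → Prime a → M ^ suc k < a → a < 3 * M ^ suc k →
    ∀ (ι : Vec (Fin M) (suc k) → Fin (M ^ suc k)) → Injective _≡_ _≡_ ι →
    ∀ (x : Vec (Fin M) (suc k) → ℤ) →
    (∀ (ℓ : Fin (suc k)) (r : Vec (Fin M) k) (j : Fin (M / t)) → xA a ι x ℓ r j ≡ + 0) →
    Legal t (λ e → ¬ (x e ≡ + 0)) (λ e → ¬? (x e ≟ + 0))
lemma4p7 d N M H β _ _ t k _ _ a a-prime M^q<a _ ι ι-injective x xA≡0 ℓ r =
  [ inj₂ , inj₁ ∘ support-short⇒empty a-prime M^q<a ι-injective (xA≡0 ℓ r) ]′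
    (ℕP.≤-total (M / t) (length support))
  where
  open Line ι x ℓ r
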